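{- Let $k,r\geq 1$, let $1\leq m\leq k$, let $I_d\subseteq\{1,2,\dots,r\}$ be a set of $d$ colours, and let $n\geq k$. Then the number of coloured permutations in $S_n^{(r)}$ that avoid every coloured pattern in $T_{k,r}^m(I_d)$ is $$|S_n^{(r)}(T_{k,r}^m(I_d))|=(k-1)!\,r^{k-1}\prod_{j=k}^n \big((r-d)j+(k-1)d\big).$$
   Context: $S_n^{(r)}$ denotes the set of coloured permutations of $\{1,\dots,n\}$ with colours $\{1,\dots,r\}$: sequences $\psi=(\alpha_1^{(v_1)},\dots,\alpha_n^{(v_n)})$ where $(\alpha_1,\dots,\alpha_n)$ is a permutation of $\{1,\dots,n\}$ and each $v_i\in\{1,\dots,r\}$ is the colour of the symbol $\alpha_i$; write $|\psi|=(\alpha_1,\dots,\alpha_n)$. For $\phi=(\tau_1^{(s_1)},\dots,\tau_k^{(s_k)})\in S_k^{(r)}$, $\psi$ contains $\phi$ if there are indices $1\leq i_1<\dots<i_k\leq n$ such that $(\alpha_{i_1},\dots,\alpha_{i_k})$ is order-isomorphic to $(\tau_1,\dots,\tau_k)$ and $v_{i_j}=s_j$ for all $j$; otherwise $\psi$ avoids $\phi$. For a set $T$ of coloured patterns, $S_n^{(r)}(T)$ is the set of $\psi\in S_n^{(r)}$ avoiding every $\phi\in T$. For $I_d\subseteq\{1,\dots,r\}$ with $|I_d|=d$ and $1\le m\le k$, $T_{k,r}^m(I_d)$ is the set of all $\phi\in S_k^{(r)}$ whose first entry is the symbol $m$ with colour in $I_d$. -}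

module Defs where

open import Data.Nat using (ℕ; zero; suc; _+_; _*_; _∸_; _<_)
open import Data.Fin using (Fin; toℕ)
open import Data.Fin.Subset using (Subset; _∈_)
open import Data.Vec using (Vec; []; _∷_; lookup)
open import Data.List using (List; map; upTo)
open import Data.Nat.ListAction using (product)
open import Data.Product using (Σ; _×_; ∃; _,_)
open import Data.Empty using (⊥)
open import Function.Bundles using (_⇔_)
open import Relation.Binary.PropositionalEquality using (_≡_)

-- Symbols are 0-based: symbol a ∈ {1..n} is represented by (a-1) : Fin n.
-- Colours are 0-based: colour c ∈ {1..r} is represented by (c-1) : Fin r.

ColWord : ℕ → ℕ → Set
ColWord n r = Vec (Fin n) n × Vec (Fin r) n

-- The symbol sequence is a permutation of {1,…,n}: injective (hence bijective).
IsPerm : ∀ {n} → Vec (Fin n) n → Set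
IsPerm {n} α = ∀ (i j : Fin n) → lookup α i ≡ lookup α j → i ≡ j

IsColPerm : ∀ {n r} → ColWord n r → Set
IsColPerm (α , _) = IsPerm α

StrictlyIncreasing : ∀ {k n} → (Fin k → Fin n) → Set
StrictlyIncreasing {k} f = ∀ (a b : Fin k) → toℕ a < toℕ b → toℕ (f a) < toℕ (f b)

Contains : ∀ {n k r} → ColWord n r → ColWord k r → Set
Contains {n} {k} {r} (α , v) (τ , s) =
  Σ (Fin k → Fin n) λ ι →
    StrictlyIncreasing ι
    × (∀ (a b : Fin k) →
         (toℕ (lookup α (ι a)) < toℕ (lookup α (ι b))) ⇔ (toℕ (lookup τ a) < toℕ (lookup τ b)))
    × (∀ (a : Fin k) → lookup v (ι a) ≡ lookup s a)

Avoids : ∀ {n k r} → ColWord n r → ColWord k r → Set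
Avoids ψ φ = Contains ψ φ → ⊥

FirstIs : ∀ {A : Set} {k} → Vec A k → A → Set
FirstIs [] x = ⊥
FirstIs (y ∷ _) x = y ≡ x

-- φ ∈ T_{k,r}^m(I): φ ∈ S_k^(r), its first entry is the symbol m
-- (i.e. 0-based value m-1) and carries a colour from I.
HasFirstSymbol : ∀ {k} → Vec (Fin k) k → ℕ → Set
HasFirstSymbol [] m = ⊥
HasFirstSymbol (y ∷ _) m = toℕ y ≡ m ∸ 1

FirstColourIn : ∀ {k r} → Vec (Fin r) k → Subset r → Set
FirstColourIn [] I = ⊥
FirstColourIn (c ∷ _) I = c ∈ I

InT : ∀ {k r} → (m : ℕ) → Subset r → ColWord k r → Set
InT m I (τ , s) = IsPerm τ × HasFirstSymbol τ m × FirstColourIn s I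

AvoidsT : ∀ {n r} → (k m : ℕ) → Subset r → ColWord n r → Set
AvoidsT {n} {r} k m I ψ = ∀ (φ : ColWord k r) → InT m I φ → Avoids ψ φ

-- ∏_{j=a}^{b} f j  (empty product = 1 when b < a)
prodFromTo : ℕ → ℕ → (ℕ → ℕ) → ℕ
prodFromTo a b f = product (map (λ i → f (a + i)) (upTo (suc b ∸ a)))

-- Write a coloured permutation of length n + 1 as a head (a , c) followed by a coloured permutation ψ
-- of length n, relabelled around a.  For k = M + D + 1 and m = M + 1, an occurrence of a pattern of T
-- either avoids the head, and then lies in ψ, or starts at it; the latter is possible exactly when
-- c ∈ I and a has at least M smaller and D larger values after it.  So the avoiders of length n + 1
-- are the (a , c) ◂ ψ with ψ an avoider and (a , c) outside a rectangle of max(0, n + 2 - k) × d heads: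
-- r (n + 1) choices while n + 1 < k and (r - d)(n + 1) + (k - 1) d afterwards.

module Submission where

open import Defs
open import Data.Fin as Fin using (Fin; zero; suc; toℕ; fromℕ; fromℕ<; punchIn; punchOut; inject₁)
import Data.Fin.Properties as Finₚ
open import Data.Fin.Subset using (Subset; ∣_∣; inside; outside) renaming (_∈_ to _∈ₛ_)
open import Data.Fin.Subset.Properties using (_∈?_; ∣p∣≤n; drop-there)
open import Data.List as List using (List; []; _∷_; length; map; filter; cartesianProduct; allFin; upTo)
import Data.List.Properties as Listₚ
open import Data.List.Membership.Propositional using (_∈_)
open import Data.List.Membership.Propositional.Properties
  using (∈-map⁺; ∈-map⁻; ∈-cartesianProduct⁺; ∈-cartesianProduct⁻; ∈-filter⁺; ∈-filter⁻; ∈-allFin)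
open import Data.List.Relation.Unary.Any using (here)
import Data.List.Relation.Unary.All as All
import Data.List.Relation.Unary.AllPairs as AllPairs
open import Data.List.Relation.Unary.Unique.Propositional using (Unique)
import Data.List.Relation.Unary.Unique.Propositional.Properties as Uniqueₚ
open import Data.Nat using (ℕ; zero; suc; _+_; _*_; _∸_; _^_; _≤_; _<_; _!; z≤n; s≤s; s≤s⁻¹; _≤?_; _<?_)
open import Data.Nat.ListAction using (product)
import Data.Nat.ListAction.Properties as ListActionₚ
open import Data.Nat.Properties
open import Data.Nat.Tactic.RingSolver using (solve-∀)
open import Data.Product using (Σ; ∃; _×_; _,_; proj₁; proj₂; uncurry)
open import Data.Sum using (_⊎_; inj₁; inj₂)
open import Data.Vec as Vec using (Vec; []; _∷_; lookup; tabulate)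
import Data.Vec.Properties as Vecₚ
open import Function using (_∘_)
open import Function.Bundles using (_⇔_; mk⇔; Equivalence)
open import Function.Definitions using (Injective)
import Function.Properties.Equivalence as ⇔
open import Relation.Binary.Definitions using (tri<; tri≈; tri>)
open import Relation.Binary.PropositionalEquality
open import Relation.Nullary using (Dec; yes; no; contradiction)
open import Relation.Nullary.Decidable using (_×-dec_)
open import Relation.Unary using (Pred; Decidable; ∁; _⟨×⟩_)
open import Relation.Unary.Properties using (∁?; _×?_)

private variable
  k n r : ℕ

injective⇒surjective : (f : Fin n → Fin n) → Injective _≡_ _≡_ f → ∀ y → ∃ λ x → f x ≡ y
injective⇒surjective {suc n} f f-inj y with Finₚ.any? (λ x → f x Finₚ.≟ y)
... | yes hit = hit
... | no miss = contradiction (Finₚ.injective⇒≤ punchOut∘f-injective) 1+n≰n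
  where
  y≢f : ∀ x → y ≢ f x
  y≢f x y≡fx = miss (x , sym y≡fx)

  punchOut∘f-injective : Injective _≡_ _≡_ (λ x → punchOut (y≢f x))
  punchOut∘f-injective eq = f-inj (Finₚ.punchOut-injective (y≢f _) (y≢f _) eq)

strictlyIncreasing⇒injective : {ι : Fin k → Fin n} → StrictlyIncreasing ι → Injective _≡_ _≡_ ι
strictlyIncreasing⇒injective {ι = ι} ι-inc {x} {y} ιx≡ιy with <-cmp (toℕ x) (toℕ y)
... | tri< x<y _ _ = contradiction (cong toℕ ιx≡ιy) (<⇒≢ (ι-inc x y x<y))
... | tri≈ _ x≡y _ = Finₚ.toℕ-injective x≡y
... | tri> _ _ y<x = contradiction (cong toℕ ιx≡ιy) (>⇒≢ (ι-inc y x y<x))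

lift₁-strictlyIncreasing : {ι : Fin k → Fin n} → StrictlyIncreasing ι → StrictlyIncreasing (Fin.lift 1 ι)
lift₁-strictlyIncreasing ι-inc zero    (suc y) _         = s≤s z≤n
lift₁-strictlyIncreasing ι-inc (suc x) (suc y) (s≤s x<y) = s≤s (ι-inc x y x<y)

strictlyIncreasing-+ : (f : Fin n → ℕ) → (∀ x y → toℕ x < toℕ y → f x < f y) →
                       ∀ d x y → toℕ x + d ≡ toℕ y → f x + d ≤ f y
strictlyIncreasing-+ f f-inc zero x y x+0≡y =
  ≤-reflexive (trans (+-identityʳ (f x)) (cong f (Finₚ.toℕ-injective (trans (sym (+-identityʳ (toℕ x))) x+0≡y))))
strictlyIncreasing-+ f f-inc (suc d) x zero x+d+1≡0 = contradiction (trans (sym x+d+1≡0) (+-suc (toℕ x) d)) 0≢1+n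
strictlyIncreasing-+ {suc n} f f-inc (suc d) x (suc y) x+d+1≡y+1 = begin
  f x + suc d          ≡⟨ +-suc (f x) d ⟩
  suc (f x + d)        ≤⟨ s≤s (strictlyIncreasing-+ f f-inc d x (inject₁ y) x+d≡y) ⟩
  suc (f (inject₁ y))  ≤⟨ f-inc (inject₁ y) (suc y) (s≤s (≤-reflexive (Finₚ.toℕ-inject₁ y))) ⟩
  f (suc y)            ∎
  where
  open ≤-Reasoning
  x+d≡y : toℕ x + d ≡ toℕ (inject₁ y)
  x+d≡y = trans (suc-injective (trans (sym (+-suc (toℕ x) d)) x+d+1≡y+1)) (sym (Finₚ.toℕ-inject₁ y))

increasingChoice : ∀ {t j ℓ} (P : Pred (Fin t) ℓ) (g : Fin j → Fin t) → Injective _≡_ _≡_ g → (∀ b → P (g b)) →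
                   ∃ λ (ι : Fin j → Fin t) → StrictlyIncreasing ι × ∀ b → P (ι b)
increasingChoice {j = zero} _ _ _ _ = (λ ()) , (λ ()) , (λ ())
increasingChoice {zero} {suc _} _ g _ _ with () ← g zero
increasingChoice {suc t} {suc j} P g g-inj Pg = choose (Finₚ.any? (λ b → zero Finₚ.≟ g b))
  where
  avoidingZero : ∀ {i} (h : Fin i → Fin (suc t)) → Injective _≡_ _≡_ h → (∀ b → zero ≢ h b) → (∀ b → P (h b)) →
                 ∃ λ (ι : Fin i → Fin t) → StrictlyIncreasing ι × ∀ b → P (suc (ι b))
  avoidingZero h h-inj 0∉h Ph =
    increasingChoice (P ∘ suc) (λ b → punchOut (0∉h b))
      (λ eq → h-inj (Finₚ.punchOut-injective (0∉h _) (0∉h _) eq))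
      (λ b → subst P (sym (Finₚ.punchIn-punchOut (0∉h b))) (Ph b))

  choose : Dec (∃ λ b → zero ≡ g b) → ∃ λ (ι : Fin (suc j) → Fin (suc t)) → StrictlyIncreasing ι × ∀ b → P (ι b)
  choose (yes (b₀ , 0≡gb₀)) =
    let ι , ι-inc , Pι = avoidingZero (g ∘ punchIn b₀)
                           (λ eq → Finₚ.punchIn-injective b₀ _ _ (g-inj eq))
                           (λ b 0≡g[b] → Finₚ.punchInᵢ≢i b₀ b (sym (g-inj (trans (sym 0≡gb₀) 0≡g[b]))))
                           (Pg ∘ punchIn b₀)
    in Fin.lift 1 ι , lift₁-strictlyIncreasing ι-inc , λ { zero → subst P (sym 0≡gb₀) (Pg b₀) ; (suc b) → Pι b }
  choose (no 0∉g) =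
    let ι , ι-inc , Pι = avoidingZero g g-inj (λ b 0≡gb → 0∉g (b , 0≡gb)) Pg
    in suc ∘ ι , (λ x y x<y → s≤s (ι-inc x y x<y)) , Pι

infixr 5 _◃_ _◂_

_◃_ : Fin (suc n) → Vec (Fin n) n → Vec (Fin (suc n)) (suc n)
a ◃ α = a ∷ Vec.map (punchIn a) α

_◂_ : Fin (suc n) × Fin r → ColWord n r → ColWord (suc n) r
(a , c) ◂ (α , v) = a ◃ α , c ∷ v

lookup-◃-suc : ∀ (a : Fin (suc n)) α i → lookup (a ◃ α) (suc i) ≡ punchIn a (lookup α i)
lookup-◃-suc a α i = Vecₚ.lookup-map i (punchIn a) α

punchIn-<⇔ : ∀ (a : Fin (suc n)) u w → (toℕ (punchIn a u) < toℕ (punchIn a w)) ⇔ (toℕ u < toℕ w)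
punchIn-<⇔ a u w = mk⇔
  (λ pu<pw → ≰⇒> (λ w≤u → <⇒≱ pu<pw (Finₚ.punchIn-mono-≤ a w u w≤u)))
  (λ u<w → ≰⇒> (λ pw≤pu → <⇒≱ u<w (Finₚ.punchIn-cancel-≤ a w u pw≤pu)))

◃-<⇔ : ∀ (a : Fin (suc n)) α i j →
       (toℕ (lookup (a ◃ α) (suc i)) < toℕ (lookup (a ◃ α) (suc j))) ⇔ (toℕ (lookup α i) < toℕ (lookup α j))
◃-<⇔ a α i j rewrite lookup-◃-suc a α i | lookup-◃-suc a α j = punchIn-<⇔ a _ _

toℕ-punchIn-< : ∀ {a : Fin (suc n)} {y} → toℕ y < toℕ a → toℕ (punchIn a y) ≡ toℕ y
toℕ-punchIn-< {a = suc a} {zero}  _         = refl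
toℕ-punchIn-< {a = suc a} {suc y} (s≤s y<a) = cong suc (toℕ-punchIn-< y<a)

toℕ-punchIn-≥ : ∀ {a : Fin (suc n)} {y} → toℕ a ≤ toℕ y → toℕ (punchIn a y) ≡ suc (toℕ y)
toℕ-punchIn-≥ {a = zero}  _         = refl
toℕ-punchIn-≥ {a = suc a} {suc y} (s≤s a≤y) = cong suc (toℕ-punchIn-≥ a≤y)

◃-isPerm : ∀ (a : Fin (suc n)) {α} → IsPerm α → IsPerm (a ◃ α)
◃-isPerm a α-perm zero    zero    _  = refl
◃-isPerm a {α} α-perm zero    (suc j) eq = contradiction (sym (trans eq (lookup-◃-suc a α j))) (Finₚ.punchInᵢ≢i a _)
◃-isPerm a {α} α-perm (suc i) zero    eq = contradiction (trans (sym (lookup-◃-suc a α i)) eq) (Finₚ.punchInᵢ≢i a _)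
◃-isPerm a {α} α-perm (suc i) (suc j) eq =
  cong suc (α-perm i j (Finₚ.punchIn-injective a _ _ (trans (sym (lookup-◃-suc a α i)) (trans eq (lookup-◃-suc a α j)))))

map-punchIn-injective : ∀ (a : Fin (suc n)) {j} → Injective _≡_ _≡_ (Vec.map {n = j} (punchIn a))
map-punchIn-injective a {x = []}     {[]}     _  = refl
map-punchIn-injective a {x = x ∷ xs} {y ∷ ys} eq =
  cong₂ _∷_ (Finₚ.punchIn-injective a x y (Vecₚ.∷-injectiveˡ eq)) (map-punchIn-injective a (Vecₚ.∷-injectiveʳ eq))

◂-injective : {e e′ : Fin (suc n) × Fin r} {ψ ψ′ : ColWord n r} → e ◂ ψ ≡ e′ ◂ ψ′ → (e , ψ) ≡ (e′ , ψ′)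
◂-injective {e = a , c} {ψ = α , v} {α′ , v′} eq
  with refl , α≡α′ ← Vecₚ.∷-injective (cong proj₁ eq) | refl , refl ← Vecₚ.∷-injective (cong proj₂ eq)
  = cong (λ α″ → (a , c) , α″ , v) (map-punchIn-injective a α≡α′)

◂-surjective : (ψ : ColWord (suc n) r) → IsColPerm ψ →
               Σ ((Fin (suc n) × Fin r) × ColWord n r) λ (e , ψ′) → IsColPerm ψ′ × e ◂ ψ′ ≡ ψ
◂-surjective {n} (a ∷ β , c ∷ v) ψ-perm =
  ((a , c) , α , v) , α-perm , cong (λ β′ → a ∷ β′ , c ∷ v) map-punchIn-α≡β
  where
  a≢β : ∀ i → a ≢ lookup β i
  a≢β i a≡βi with () ← ψ-perm zero (suc i) a≡βi

  α : Vec (Fin n) n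
  α = tabulate (λ i → punchOut (a≢β i))

  α-perm : IsPerm α
  α-perm i j eq = Finₚ.suc-injective (ψ-perm (suc i) (suc j) (Finₚ.punchOut-injective (a≢β i) (a≢β j)
    (trans (sym (Vecₚ.lookup∘tabulate _ i)) (trans eq (Vecₚ.lookup∘tabulate _ j)))))

  map-punchIn-α≡β : Vec.map (punchIn a) α ≡ β
  map-punchIn-α≡β = trans (sym (Vecₚ.tabulate-∘ (punchIn a) _))
    (trans (Vecₚ.tabulate-cong (λ i → Finₚ.punchIn-punchOut (a≢β i))) (Vecₚ.tabulate∘lookup β))

◂-contains : ∀ (e : Fin (suc n) × Fin r) {ψ} {φ : ColWord k r} → Contains ψ φ → Contains (e ◂ ψ) φ
◂-contains (a , c) {α , v} (ι , ι-inc , ι-iso , ι-col) =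
  suc ∘ ι , (λ x y x<y → s≤s (ι-inc x y x<y)) , (λ x y → ⇔.trans (◃-<⇔ a α (ι x) (ι y)) (ι-iso x y)) , ι-col

◂-contains-tail : ∀ (e : Fin (suc n) × Fin r) {ψ} {φ : ColWord (suc k) r} (C : Contains (e ◂ ψ) φ) →
                  proj₁ C zero ≢ zero → Contains ψ φ
◂-contains-tail {n = n} {k = k} (a , c) {α , v} {τ , s} (ι , ι-inc , ι-iso , ι-col) ι0≢0 =
  ι′ , ι′-inc , ι′-iso , ι′-col
  where
  0∉ι : ∀ x → zero ≢ ι x
  0∉ι zero    0≡ι0 = ι0≢0 (sym 0≡ι0)
  0∉ι (suc x) 0≡ιx = n≮0 (subst (λ z → toℕ (ι zero) < toℕ z) (sym 0≡ιx) (ι-inc zero (suc x) (s≤s z≤n)))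

  ι′ : Fin (suc k) → Fin n
  ι′ x = punchOut (0∉ι x)

  ι≡suc∘ι′ : ∀ x → ι x ≡ suc (ι′ x)
  ι≡suc∘ι′ x = sym (Finₚ.punchIn-punchOut (0∉ι x))

  ι′-inc : StrictlyIncreasing ι′
  ι′-inc x y x<y = s≤s⁻¹ (subst₂ (λ p q → toℕ p < toℕ q) (ι≡suc∘ι′ x) (ι≡suc∘ι′ y) (ι-inc x y x<y))

  ι′-iso : ∀ x y → (toℕ (lookup α (ι′ x)) < toℕ (lookup α (ι′ y))) ⇔ (toℕ (lookup τ x) < toℕ (lookup τ y))
  ι′-iso x y = ⇔.trans (⇔.sym (◃-<⇔ a α (ι′ x) (ι′ y)))
    (subst₂ (λ p q → (toℕ (lookup (a ◃ α) p) < toℕ (lookup (a ◃ α) q)) ⇔ _)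
            (ι≡suc∘ι′ x) (ι≡suc∘ι′ y) (ι-iso x y))

  ι′-col : ∀ x → lookup v (ι′ x) ≡ lookup s x
  ι′-col x = subst (λ p → lookup (c ∷ v) p ≡ lookup s x) (ι≡suc∘ι′ x) (ι-col x)

occurrence-bounds : ∀ {K} {α : Vec (Fin (suc n)) (suc n)} {v : Vec (Fin r) (suc n)} {τ : Vec (Fin (suc K)) (suc K)} {s} →
  IsPerm τ → ((ι , _) : Contains (α , v) (τ , s)) → ∀ x →
  toℕ (lookup τ x) ≤ toℕ (lookup α (ι x)) × toℕ (lookup α (ι x)) + (K ∸ toℕ (lookup τ x)) ≤ n
occurrence-bounds {n} {K = K} {α} {τ = τ} τ-perm (ι , _ , ι-iso , _) x = lower , upper
  where
  τ⁻¹ : Fin (suc K) → Fin (suc K)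
  τ⁻¹ t = proj₁ (injective⇒surjective (lookup τ) (τ-perm _ _) t)

  τ∘τ⁻¹ : ∀ t → lookup τ (τ⁻¹ t) ≡ t
  τ∘τ⁻¹ t = proj₂ (injective⇒surjective (lookup τ) (τ-perm _ _) t)

  f : Fin (suc K) → ℕ
  f t = toℕ (lookup α (ι (τ⁻¹ t)))

  f-inc : ∀ t u → toℕ t < toℕ u → f t < f u
  f-inc t u t<u = Equivalence.from (ι-iso (τ⁻¹ t) (τ⁻¹ u))
    (subst₂ (λ p q → toℕ p < toℕ q) (sym (τ∘τ⁻¹ t)) (sym (τ∘τ⁻¹ u)) t<u)

  t : Fin (suc K)
  t = lookup τ x

  f[t]≡ψ[ιx] : f t ≡ toℕ (lookup α (ι x))
  f[t]≡ψ[ιx] = cong (λ y → toℕ (lookup α (ι y))) (τ-perm _ _ (τ∘τ⁻¹ t))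

  lower : toℕ t ≤ toℕ (lookup α (ι x))
  lower = ≤-trans (m≤n+m (toℕ t) (f zero))
    (≤-trans (strictlyIncreasing-+ f f-inc (toℕ t) zero t refl) (≤-reflexive f[t]≡ψ[ιx]))

  upper : toℕ (lookup α (ι x)) + (K ∸ toℕ t) ≤ n
  upper = s≤s⁻¹ (begin-strict
    toℕ (lookup α (ι x)) + (K ∸ toℕ t) ≡⟨ cong (_+ (K ∸ toℕ t)) (sym f[t]≡ψ[ιx]) ⟩
    f t + (K ∸ toℕ t)                  ≤⟨ strictlyIncreasing-+ f f-inc (K ∸ toℕ t) t (fromℕ K) t+[K∸t]≡K ⟩
    f (fromℕ K)                        <⟨ Finₚ.toℕ<n _ ⟩
    suc n                              ∎)
    where
    open ≤-Reasoning
    t+[K∸t]≡K : toℕ t + (K ∸ toℕ t) ≡ toℕ (fromℕ K)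
    t+[K∸t]≡K = trans (m+[n∸m]≡n (s≤s⁻¹ (Finₚ.toℕ<n t))) (sym (Finₚ.toℕ-fromℕ K))

-- With 0-based values, a head x among n + 1 symbols has x smaller and n ∸ x larger ones;
-- it can be the first entry (symbol M + 1) of a pattern of length M + D + 1 iff InWindow M D n x.
InWindow : ℕ → ℕ → ℕ → ℕ → Set
InWindow M D n x = M ≤ x × x + D ≤ n

head-occurrence⇒inWindow : ∀ {M D} {I : Subset r} {a : Fin (suc n)} {c α v} {φ : ColWord (suc (M + D)) r} →
  InT (suc M) I φ → (C : Contains ((a , c) ◂ (α , v)) φ) → proj₁ C zero ≡ zero → InWindow M D n (toℕ a) × c ∈ₛ I
head-occurrence⇒inWindow {n = n} {M} {D} {I} {a} {c} {α} {v} {t₀ ∷ τ , s₀ ∷ s}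
                         (τ-perm , t₀≡M , s₀∈I) C@(ι , _ , _ , ι-col) ι0≡0 =
  (subst₂ _≤_ t₀≡M (cong toℕ head) (proj₁ bounds) ,
   subst₂ (λ p d → toℕ p + d ≤ n) head (trans (cong (M + D ∸_) t₀≡M) (m+n∸m≡n M D)) (proj₂ bounds)) ,
  subst (_∈ₛ I) (sym c≡s₀) s₀∈I
  where
  bounds : toℕ t₀ ≤ toℕ (lookup (a ◃ α) (ι zero)) × toℕ (lookup (a ◃ α) (ι zero)) + (M + D ∸ toℕ t₀) ≤ n
  bounds = occurrence-bounds {α = a ◃ α} {c ∷ v} {t₀ ∷ τ} {s₀ ∷ s} τ-perm C zero

  head : lookup (a ◃ α) (ι zero) ≡ a
  head = cong (lookup (a ◃ α)) ι0≡0

  c≡s₀ : c ≡ s₀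
  c≡s₀ = trans (cong (lookup (c ∷ v)) (sym ι0≡0)) (ι-col zero)

module Relabel {p} {S : Pred ℕ p} (f : ℕ → ℕ) (f-mono : ∀ {x y} → S x → S y → x < y → f x < f y)
               {k} (σ : Fin k → ℕ) (σ∈S : ∀ x → S (σ x)) (f∘σ<k : ∀ x → f (σ x) < k) where

  relabel : Vec (Fin k) k
  relabel = tabulate (λ x → fromℕ< (f∘σ<k x))

  toℕ-relabel : ∀ x → toℕ (lookup relabel x) ≡ f (σ x)
  toℕ-relabel x = trans (cong toℕ (Vecₚ.lookup∘tabulate (λ x → fromℕ< (f∘σ<k x)) x)) (Finₚ.toℕ-fromℕ< (f∘σ<k x))

  relabel-<⇔ : ∀ x y → (σ x < σ y) ⇔ (toℕ (lookup relabel x) < toℕ (lookup relabel y))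
  relabel-<⇔ x y = subst₂ (λ p q → (σ x < σ y) ⇔ (p < q)) (sym (toℕ-relabel x)) (sym (toℕ-relabel y))
                          (mk⇔ (f-mono (σ∈S x) (σ∈S y)) reflect)
    where
    reflect : f (σ x) < f (σ y) → σ x < σ y
    reflect fσx<fσy with <-cmp (σ x) (σ y)
    ... | tri< σx<σy _ _ = σx<σy
    ... | tri≈ _ σx≡σy _ = contradiction fσx<fσy (<-irrefl (cong f σx≡σy))
    ... | tri> _ _ σy<σx = contradiction fσx<fσy (<-asym (f-mono (σ∈S y) (σ∈S x) σy<σx))

  relabel-isPerm : (∀ x y → σ x ≡ σ y → x ≡ y) → IsPerm relabel
  relabel-isPerm σ-inj x y τx≡τy with <-cmp (σ x) (σ y)
  ... | tri< σx<σy _ _ = contradiction (cong toℕ τx≡τy) (<⇒≢ (Equivalence.to (relabel-<⇔ x y) σx<σy))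
  ... | tri≈ _ σx≡σy _ = σ-inj x y σx≡σy
  ... | tri> _ _ σy<σx = contradiction (cong toℕ τx≡τy) (>⇒≢ (Equivalence.to (relabel-<⇔ y x) σy<σx))

increasingPositions : ∀ {j} {α : Vec (Fin n) n} → IsPerm α → (g : Fin j → Fin n) → Injective _≡_ _≡_ g →
  ∃ λ (ι : Fin j → Fin n) → StrictlyIncreasing ι × ∀ b → ∃ λ b′ → lookup α (ι b) ≡ g b′
increasingPositions {α = α} α-perm g g-inj =
  increasingChoice (λ i → ∃ λ b′ → lookup α i ≡ g b′) (position ∘ g)
    (λ eq → g-inj (trans (sym (lookup-position _)) (trans (cong (lookup α) eq) (lookup-position _))))
    (λ b → b , lookup-position (g b))
  where
  position : Fin _ → Fin _
  position y = proj₁ (injective⇒surjective (lookup α) (α-perm _ _) y)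

  lookup-position : ∀ y → lookup α (position y) ≡ y
  lookup-position y = proj₂ (injective⇒surjective (lookup α) (α-perm _ _) y)

spread : ℕ → ℕ → ℕ → ℕ
spread M A b with b <? M
... | yes _ = b
... | no _  = A + (b ∸ M)

squeeze : ℕ → ℕ → ℕ → ℕ
squeeze M A z with z <? A
... | yes _ = z
... | no _  = M + (z ∸ A)

spread-< : ∀ {M} A {b} → b < M → spread M A b ≡ b
spread-< {M} A {b} b<M with b <? M
... | yes _   = refl
... | no b≮M = contradiction b<M b≮M

spread-≥ : ∀ {M} A {b} → M ≤ b → spread M A b ≡ A + (b ∸ M)
spread-≥ {M} A {b} M≤b with b <? M
... | yes b<M = contradiction M≤b (<⇒≱ b<M)
... | no _    = refl

squeeze-< : ∀ M {A z} → z < A → squeeze M A z ≡ z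
squeeze-< M {A} {z} z<A with z <? A
... | yes _   = refl
... | no z≮A = contradiction z<A z≮A

squeeze-≥ : ∀ M {A z} → A ≤ z → squeeze M A z ≡ M + (z ∸ A)
squeeze-≥ M {A} {z} A≤z with z <? A
... | yes z<A = contradiction A≤z (<⇒≱ z<A)
... | no _    = refl

squeeze∘spread : ∀ {M A} → M ≤ A → ∀ b → squeeze M A (spread M A b) ≡ b
squeeze∘spread {M} {A} M≤A b with b <? M
... | yes b<M = squeeze-< M (<-≤-trans b<M M≤A)
... | no b≮M  = begin
  squeeze M A (A + (b ∸ M)) ≡⟨ squeeze-≥ M (m≤m+n A (b ∸ M)) ⟩
  M + (A + (b ∸ M) ∸ A)     ≡⟨ cong (M +_) (m+n∸m≡n A (b ∸ M)) ⟩
  M + (b ∸ M)               ≡⟨ m+[n∸m]≡n (≮⇒≥ b≮M) ⟩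
  b                         ∎
  where open ≡-Reasoning

Kept : ℕ → ℕ → ℕ → ℕ → Set
Kept M A D z = z < M ⊎ (A ≤ z × z ≤ A + D)

squeeze-strictMono : ∀ {M A D} → M ≤ A → ∀ {z z′} → Kept M A D z → Kept M A D z′ →
                     z < z′ → squeeze M A z < squeeze M A z′
squeeze-strictMono {M} M≤A (inj₁ z<M) (inj₁ z′<M) z<z′
  rewrite squeeze-< M (<-≤-trans z<M M≤A) | squeeze-< M (<-≤-trans z′<M M≤A) = z<z′
squeeze-strictMono {M} {A} M≤A {z} {z′} (inj₁ z<M) (inj₂ (A≤z′ , _)) _
  rewrite squeeze-< M (<-≤-trans z<M M≤A) | squeeze-≥ M A≤z′ = <-≤-trans z<M (m≤m+n M (z′ ∸ A))
squeeze-strictMono M≤A (inj₂ (A≤z , _)) (inj₁ z′<M) z<z′ =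
  contradiction z<z′ (<-asym (<-≤-trans z′<M (≤-trans M≤A A≤z)))
squeeze-strictMono {M} M≤A (inj₂ (A≤z , _)) (inj₂ (A≤z′ , _)) z<z′
  rewrite squeeze-≥ M A≤z | squeeze-≥ M A≤z′ = +-monoʳ-< M (∸-monoˡ-< z<z′ A≤z)

squeeze-≤ : ∀ {M A D} → M ≤ A → ∀ {z} → Kept M A D z → squeeze M A z ≤ M + D
squeeze-≤ {M} {A} {D} M≤A (inj₁ z<M) rewrite squeeze-< M (<-≤-trans z<M M≤A) = ≤-trans (<⇒≤ z<M) (m≤m+n M D)
squeeze-≤ {M} {A} {D} M≤A {z} (inj₂ (A≤z , z≤A+D)) rewrite squeeze-≥ M A≤z =
  +-monoʳ-≤ M (≤-trans (∸-monoˡ-≤ A z≤A+D) (≤-reflexive (m+n∸m≡n A D)))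

module _ {M D n} (a : Fin (suc n)) (M≤a : M ≤ toℕ a) (a+D≤n : toℕ a + D ≤ n) where

  private
    A : ℕ
    A = toℕ a

    offset<D : ∀ (b : Fin (M + D)) → M ≤ toℕ b → toℕ b ∸ M < D
    offset<D b M≤b = subst (toℕ b ∸ M <_) (m+n∸m≡n M D) (∸-monoˡ-< (Finₚ.toℕ<n b) M≤b)

    spread<n : ∀ (b : Fin (M + D)) → spread M A (toℕ b) < n
    spread<n b with <-≤-connex (toℕ b) M
    ... | inj₁ b<M rewrite spread-< A b<M = <-≤-trans b<M (≤-trans M≤a (≤-trans (m≤m+n A D) a+D≤n))
    ... | inj₂ M≤b rewrite spread-≥ A M≤b = <-≤-trans (+-monoʳ-< A (offset<D b M≤b)) a+D≤n

  spreadFin : Fin (M + D) → Fin n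
  spreadFin b = fromℕ< (spread<n b)

  toℕ-spreadFin : ∀ b → toℕ (spreadFin b) ≡ spread M A (toℕ b)
  toℕ-spreadFin b = Finₚ.toℕ-fromℕ< (spread<n b)

  spreadFin-injective : Injective _≡_ _≡_ spreadFin
  spreadFin-injective {x} {y} eq = Finₚ.toℕ-injective (begin
    toℕ x                            ≡⟨ sym (squeeze∘spread M≤a (toℕ x)) ⟩
    squeeze M A (spread M A (toℕ x)) ≡⟨ cong (squeeze M A) (trans (sym (toℕ-spreadFin x))
                                                               (trans (cong toℕ eq) (toℕ-spreadFin y))) ⟩
    squeeze M A (spread M A (toℕ y)) ≡⟨ squeeze∘spread M≤a (toℕ y) ⟩
    toℕ y                            ∎)
    where open ≡-Reasoning

  punchIn-spreadFin-kept : ∀ b → Kept M A D (toℕ (punchIn a (spreadFin b)))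
  punchIn-spreadFin-kept b with <-≤-connex (toℕ b) M
  ... | inj₁ b<M = inj₁ (subst (_< M) (sym (trans (toℕ-punchIn-< t<A) t≡b)) b<M)
    where
    t≡b : toℕ (spreadFin b) ≡ toℕ b
    t≡b = trans (toℕ-spreadFin b) (spread-< A b<M)
    t<A : toℕ (spreadFin b) < A
    t<A = subst (_< A) (sym t≡b) (<-≤-trans b<M M≤a)
  ... | inj₂ M≤b = inj₂ (subst (A ≤_) (sym pt≡) (≤-trans (m≤m+n A (toℕ b ∸ M)) (n≤1+n _)) ,
                        subst (_≤ A + D) (sym pt≡) (subst (_≤ A + D) (+-suc A _) (+-monoʳ-≤ A (offset<D b M≤b))))
    where
    t≡ : toℕ (spreadFin b) ≡ A + (toℕ b ∸ M)
    t≡ = trans (toℕ-spreadFin b) (spread-≥ A M≤b)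
    pt≡ : toℕ (punchIn a (spreadFin b)) ≡ suc (A + (toℕ b ∸ M))
    pt≡ = trans (toℕ-punchIn-≥ (subst (A ≤_) (sym t≡) (m≤m+n A _))) (cong suc t≡)

-- The occurrence consists of the head, the values 0, …, M - 1 and the D values just above the head;
-- squeeze relabels these onto 0, …, M + D preserving order, which yields a pattern of T.
inWindow⇒contains-T : ∀ {M D} {I : Subset r} {a : Fin (suc n)} {c α v} → IsPerm α → c ∈ₛ I → InWindow M D n (toℕ a) →
  ∃ λ (φ : ColWord (suc (M + D)) r) → InT (suc M) I φ × Contains ((a , c) ◂ (α , v)) φ
inWindow⇒contains-T {r = r} {n = n} {M = M} {D} {I} {a} {c} {α} {v} α-perm c∈I (M≤A , A+D≤n) =
  (relabel , s) , (relabel-isPerm σ-injective , τ-head , c∈I) , ι , ι-inc , relabel-<⇔ , ι-col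
  where
  A : ℕ
  A = toℕ a

  chosen : ∃ λ (ι′ : Fin (M + D) → Fin n) →
             StrictlyIncreasing ι′ × ∀ b → ∃ λ b′ → lookup α (ι′ b) ≡ spreadFin a M≤A A+D≤n b′
  chosen = increasingPositions {α = α} α-perm (spreadFin a M≤A A+D≤n) (spreadFin-injective a M≤A A+D≤n)

  ι : Fin (suc (M + D)) → Fin (suc n)
  ι = Fin.lift 1 (proj₁ chosen)

  ι-inc : StrictlyIncreasing ι
  ι-inc = lift₁-strictlyIncreasing (proj₁ (proj₂ chosen))

  σ : Fin (suc (M + D)) → ℕ
  σ x = toℕ (lookup (a ◃ α) (ι x))

  σ-injective : ∀ x y → σ x ≡ σ y → x ≡ y
  σ-injective x y σx≡σy = strictlyIncreasing⇒injective ι-inc (◃-isPerm a α-perm _ _ (Finₚ.toℕ-injective σx≡σy))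

  σ-kept : ∀ x → Kept M A D (σ x)
  σ-kept zero    = inj₂ (≤-refl , m≤m+n A D)
  σ-kept (suc b) with b′ , αι′b≡ ← proj₂ (proj₂ chosen) b =
    subst (Kept M A D ∘ toℕ) (sym (trans (lookup-◃-suc a α _) (cong (punchIn a) αι′b≡)))
      (punchIn-spreadFin-kept a M≤A A+D≤n b′)

  open Relabel (squeeze M A) (squeeze-strictMono M≤A) σ σ-kept (λ x → s≤s (squeeze-≤ M≤A (σ-kept x)))

  τ-head : toℕ (lookup relabel zero) ≡ M
  τ-head = trans (toℕ-relabel zero) (trans (squeeze-≥ M (≤-refl {A})) (trans (cong (M +_) (n∸n≡0 A)) (+-identityʳ M)))

  s : Vec (Fin r) (suc (M + D))
  s = tabulate (λ x → lookup (c ∷ v) (ι x))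

  ι-col : ∀ x → lookup (c ∷ v) (ι x) ≡ lookup s x
  ι-col x = sym (Vecₚ.lookup∘tabulate (λ x → lookup (c ∷ v) (ι x)) x)

length-filter-map : ∀ {a b ℓ} {A : Set a} {B : Set b} {Q : Pred B ℓ} (Q? : Decidable Q) (f : A → B) (xs : List A) →
                    length (filter Q? (map f xs)) ≡ length (filter (Q? ∘ f) xs)
length-filter-map Q? f []       = refl
length-filter-map Q? f (x ∷ xs) with Q? (f x)
... | yes _ = cong suc (length-filter-map Q? f xs)
... | no _  = length-filter-map Q? f xs

length-filter-∁ : ∀ {a ℓ} {A : Set a} {P : Pred A ℓ} (P? : Decidable P) (xs : List A) →
                  length (filter P? xs) + length (filter (∁? P?) xs) ≡ length xs
length-filter-∁ P? []       = refl
length-filter-∁ P? (x ∷ xs) with P? x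
... | yes _ = cong suc (length-filter-∁ P? xs)
... | no _  = trans (+-suc _ _) (cong suc (length-filter-∁ P? xs))

length-filter-++ : ∀ {a ℓ} {A : Set a} {P : Pred A ℓ} (P? : Decidable P) (xs ys : List A) →
                   length (filter P? (xs List.++ ys)) ≡ length (filter P? xs) + length (filter P? ys)
length-filter-++ P? xs ys = trans (cong length (Listₚ.filter-++ P? xs ys)) (Listₚ.length-++ (filter P? xs))

length-cartesianProduct : ∀ {a b} {A : Set a} {B : Set b} (xs : List A) (ys : List B) →
                          length (cartesianProduct xs ys) ≡ length xs * length ys
length-cartesianProduct []       ys = refl
length-cartesianProduct (x ∷ xs) ys = trans (Listₚ.length-++ (map (x ,_) ys))
  (cong₂ _+_ (Listₚ.length-map (x ,_) ys) (length-cartesianProduct xs ys))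

length-filter-∁×-cartesianProduct : ∀ {a b ℓ₁ ℓ₂} {A : Set a} {B : Set b} {P : Pred A ℓ₁} {Q : Pred B ℓ₂}
  (P? : Decidable P) (Q? : Decidable Q) (xs : List A) (ys : List B) →
  length (filter (∁? (P? ×? Q?)) (cartesianProduct xs ys)) + length (filter P? xs) * length (filter Q? ys)
    ≡ length xs * length ys
length-filter-∁×-cartesianProduct P? Q? []       ys = refl
length-filter-∁×-cartesianProduct {P = P} {Q} P? Q? (x ∷ xs) ys = begin
  length (filter R? (map (x ,_) ys List.++ cartesianProduct xs ys)) + length (filter P? (x ∷ xs)) * q
    ≡⟨ cong (λ l → length (filter R? (map (x ,_) ys List.++ cartesianProduct xs ys)) + l * q)
            (length-filter-++ P? (x ∷ []) xs) ⟩
  length (filter R? (map (x ,_) ys List.++ cartesianProduct xs ys)) + (pₓ + p) * q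
    ≡⟨ cong (_+ (pₓ + p) * q) (length-filter-++ R? (map (x ,_) ys) (cartesianProduct xs ys)) ⟩
  length (filter R? (map (x ,_) ys)) + rest + (pₓ + p) * q
    ≡⟨ cong (λ l → l + rest + (pₓ + p) * q) (length-filter-map R? (x ,_) ys) ⟩
  row + rest + (pₓ + p) * q
    ≡⟨ regroup row rest pₓ p q ⟩
  (row + pₓ * q) + (rest + p * q)
    ≡⟨ cong₂ _+_ (row-length (P? x)) (length-filter-∁×-cartesianProduct P? Q? xs ys) ⟩
  length ys + length xs * length ys ∎
  where
  open ≡-Reasoning
  R? : Decidable (∁ (P ⟨×⟩ Q))
  R? = ∁? (P? ×? Q?)

  rest row pₓ p q : ℕ
  rest = length (filter R? (cartesianProduct xs ys))
  row  = length (filter (R? ∘ (x ,_)) ys)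
  pₓ   = length (filter P? (x ∷ []))
  p    = length (filter P? xs)
  q    = length (filter Q? ys)

  regroup : ∀ a b c d e → a + b + (c + d) * e ≡ (a + c * e) + (b + d * e)
  regroup = solve-∀

  row-length : Dec (P x) → row + pₓ * q ≡ length ys
  row-length (yes Px) = begin
    row + pₓ * q                       ≡⟨ cong₂ (λ l m → length l + length m * q)
                                            (Listₚ.filter-≐ (R? ∘ (x ,_)) (∁? Q?)
                                              ((λ ¬PQ Qy → ¬PQ (Px , Qy)) , λ ¬Qy (_ , Qy) → ¬Qy Qy) ys)
                                            (Listₚ.filter-accept P? Px) ⟩
    length (filter (∁? Q?) ys) + (q + 0) ≡⟨ cong (length (filter (∁? Q?) ys) +_) (+-identityʳ q) ⟩
    length (filter (∁? Q?) ys) + q     ≡⟨ +-comm _ q ⟩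
    q + length (filter (∁? Q?) ys)     ≡⟨ length-filter-∁ Q? ys ⟩
    length ys                          ∎
  row-length (no ¬Px) = begin
    row + pₓ * q ≡⟨ cong₂ (λ l m → length l + length m * q)
                      (Listₚ.filter-all (R? ∘ (x ,_)) (All.universal (λ _ (Px , _) → ¬Px Px) ys))
                      (Listₚ.filter-reject P? ¬Px) ⟩
    length ys + 0 ≡⟨ +-identityʳ _ ⟩
    length ys ∎

length-filter-allFin-suc : ∀ {ℓ₁ ℓ₂} {P : Pred (Fin (suc n)) ℓ₁} {Q : Pred (Fin n) ℓ₂}
  (P? : Decidable P) (Q? : Decidable Q) → (∀ {x} → P (suc x) ⇔ Q x) →
  length (filter P? (allFin (suc n))) ≡ length (filter P? (zero ∷ [])) + length (filter Q? (allFin n))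
length-filter-allFin-suc {n} P? Q? P∘suc⇔Q = begin
  length (filter P? (zero ∷ List.tabulate suc))
    ≡⟨ length-filter-++ P? (zero ∷ []) (List.tabulate suc) ⟩
  length (filter P? (zero ∷ [])) + length (filter P? (List.tabulate suc))
    ≡⟨ cong (λ l → length (filter P? (zero ∷ [])) + length (filter P? l)) (sym (Listₚ.map-tabulate (λ x → x) suc)) ⟩
  length (filter P? (zero ∷ [])) + length (filter P? (map suc (allFin n)))
    ≡⟨ cong (length (filter P? (zero ∷ [])) +_) (length-filter-map P? suc (allFin n)) ⟩
  length (filter P? (zero ∷ [])) + length (filter (P? ∘ suc) (allFin n))
    ≡⟨ cong (λ l → length (filter P? (zero ∷ [])) + length l)
            (Listₚ.filter-≐ (P? ∘ suc) Q? (Equivalence.to P∘suc⇔Q , Equivalence.from P∘suc⇔Q) (allFin n)) ⟩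
  length (filter P? (zero ∷ [])) + length (filter Q? (allFin n)) ∎
  where open ≡-Reasoning

length-filter-∈ : (I : Subset r) → length (filter (_∈? I) (allFin r)) ≡ ∣ I ∣
length-filter-∈ []      = refl
length-filter-∈ (s ∷ I) = trans (length-filter-allFin-suc (_∈? s ∷ I) (_∈? I) (mk⇔ drop-there Vec.there))
                                (head-count s)
  where
  head-count : ∀ s → length (filter (_∈? s ∷ I) (zero ∷ [])) + length (filter (_∈? I) (allFin _)) ≡ ∣ s ∷ I ∣
  head-count inside  = cong suc (length-filter-∈ I)
  head-count outside = length-filter-∈ I

inWindow? : ∀ M D n x → Dec (InWindow M D n x)
inWindow? M D n x = M ≤? x ×-dec x + D ≤? n

length-filter-inWindow : ∀ M D n → length (filter (inWindow? M D n ∘ toℕ) (allFin (suc n))) ≡ suc n ∸ (M + D)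
length-filter-inWindow (suc M) D zero = sym (0∸n≡0 (M + D))
length-filter-inWindow (suc M) D (suc n) =
  trans (length-filter-allFin-suc {n = suc n} (inWindow? (suc M) D (suc n) ∘ toℕ) (inWindow? M D n ∘ toℕ)
          (mk⇔ (λ (M<x , x+D<n) → s≤s⁻¹ M<x , s≤s⁻¹ x+D<n) (λ (M≤x , x+D≤n) → s≤s M≤x , s≤s x+D≤n)))
        (length-filter-inWindow M D n)
length-filter-inWindow zero zero    zero = refl
length-filter-inWindow zero (suc D) zero = sym (0∸n≡0 D)
length-filter-inWindow zero D (suc n) =
  trans (length-filter-allFin-suc {n = suc n} (inWindow? 0 D (suc n) ∘ toℕ) (inWindow? 0 D n ∘ toℕ)
          (mk⇔ (λ (_ , x+D<n) → z≤n , s≤s⁻¹ x+D<n) (λ (_ , x+D≤n) → z≤n , s≤s x+D≤n)))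
        (trans (cong (length (filter (inWindow? 0 D (suc n) ∘ toℕ) (zero ∷ [])) +_) (length-filter-inWindow 0 D n))
               (head-count (D ≤? suc n)))
  where
  head-count : Dec (D ≤ suc n) → length (filter (inWindow? 0 D (suc n) ∘ toℕ) (zero ∷ [])) + (suc n ∸ D) ≡ suc (suc n) ∸ D
  head-count (yes D≤n+1) = begin
    length (filter (inWindow? 0 D (suc n) ∘ toℕ) (zero ∷ [])) + (suc n ∸ D)
      ≡⟨ cong (λ l → length l + (suc n ∸ D)) (Listₚ.filter-accept (inWindow? 0 D (suc n) ∘ toℕ) (z≤n , D≤n+1)) ⟩
    1 + (suc n ∸ D)
      ≡⟨ sym (+-∸-assoc 1 D≤n+1) ⟩
    suc (suc n) ∸ D ∎
    where open ≡-Reasoning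
  head-count (no D≰n+1) = begin
    length (filter (inWindow? 0 D (suc n) ∘ toℕ) (zero ∷ [])) + (suc n ∸ D)
      ≡⟨ cong (λ l → length l + (suc n ∸ D)) (Listₚ.filter-reject (inWindow? 0 D (suc n) ∘ toℕ) (D≰n+1 ∘ proj₂)) ⟩
    suc n ∸ D
      ≡⟨ m≤n⇒m∸n≡0 (<⇒≤ (≰⇒> D≰n+1)) ⟩
    0
      ≡⟨ sym (m≤n⇒m∸n≡0 (≰⇒> D≰n+1)) ⟩
    suc (suc n) ∸ D ∎
    where open ≡-Reasoning

product-map-upTo-suc : ∀ (f : ℕ → ℕ) t → product (map f (upTo (suc t))) ≡ product (map f (upTo t)) * f t
product-map-upTo-suc f t = begin
  product (map f (upTo (suc t)))                     ≡⟨ cong (product ∘ map f) (sym (Listₚ.upTo-∷ʳ t)) ⟩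
  product (map f (upTo t List.++ t ∷ []))            ≡⟨ cong product (Listₚ.map-++ f (upTo t) (t ∷ [])) ⟩
  product (map f (upTo t) List.++ f t ∷ [])          ≡⟨ ListActionₚ.product-++ (map f (upTo t)) (f t ∷ []) ⟩
  product (map f (upTo t)) * (f t * 1)               ≡⟨ cong (product (map f (upTo t)) *_) (*-identityʳ (f t)) ⟩
  product (map f (upTo t)) * f t                     ∎
  where open ≡-Reasoning

module _ (M D : ℕ) {r : ℕ} (I : Subset r) where

  K : ℕ
  K = M + D

  Admissible : Fin (suc n) × Fin r → Set
  Admissible {n} = ∁ ((InWindow M D n ∘ toℕ) ⟨×⟩ (_∈ₛ I))

  admissible? : Decidable (Admissible {n})
  admissible? {n} = ∁? ((inWindow? M D n ∘ toℕ) ×? (_∈? I))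

  avoidsT-◂ : ∀ (e : Fin (suc n) × Fin r) {ψ} → IsColPerm ψ →
              AvoidsT (suc K) (suc M) I (e ◂ ψ) ⇔ (Admissible e × AvoidsT (suc K) (suc M) I ψ)
  avoidsT-◂ (a , c) {α , v} α-perm = mk⇔ to from
    where
    to : AvoidsT (suc K) (suc M) I ((a , c) ◂ (α , v)) → Admissible (a , c) × AvoidsT (suc K) (suc M) I (α , v)
    to e◂ψ-avoids =
      (λ (a-inWindow , c∈I) → let φ , φ∈T , C = inWindow⇒contains-T {v = v} α-perm c∈I a-inWindow in e◂ψ-avoids φ φ∈T C) ,
      (λ φ φ∈T C → e◂ψ-avoids φ φ∈T (◂-contains (a , c) {α , v} {φ} C))

    from : Admissible (a , c) × AvoidsT (suc K) (suc M) I (α , v) → AvoidsT (suc K) (suc M) I ((a , c) ◂ (α , v))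
    from (admissible , ψ-avoids) φ φ∈T C with proj₁ C zero Finₚ.≟ zero
    ... | yes ι0≡0 = admissible (head-occurrence⇒inWindow {α = α} {v} {φ} φ∈T C ι0≡0)
    ... | no ι0≢0  = ψ-avoids φ φ∈T (◂-contains-tail (a , c) {α , v} {φ} C ι0≢0)

  heads : ∀ n → List (Fin (suc n) × Fin r)
  heads n = filter admissible? (cartesianProduct (allFin (suc n)) (allFin r))

  avoiders : ∀ n → List (ColWord n r)
  avoiders zero    = ([] , []) ∷ []
  avoiders (suc n) = map (uncurry _◂_) (cartesianProduct (heads n) (avoiders n))

  avoiders-unique : ∀ n → Unique (avoiders n)
  avoiders-unique zero    = All.[] AllPairs.∷ AllPairs.[]
  avoiders-unique (suc n) = Uniqueₚ.map⁺ ◂-injective (Uniqueₚ.cartesianProduct⁺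
    (Uniqueₚ.filter⁺ admissible? (Uniqueₚ.cartesianProduct⁺ (Uniqueₚ.allFin⁺ (suc n)) (Uniqueₚ.allFin⁺ r)))
    (avoiders-unique n))

  ∈-avoiders : ∀ n (ψ : ColWord n r) → ψ ∈ avoiders n ⇔ (IsColPerm ψ × AvoidsT (suc K) (suc M) I ψ)
  ∈-avoiders zero ([] , []) = mk⇔ (λ _ → (λ ()) , λ _ _ (ι , _) → contradiction (ι zero) λ ()) (λ _ → here refl)
  ∈-avoiders (suc n) ψ = mk⇔ to from
    where
    to : ψ ∈ avoiders (suc n) → IsColPerm ψ × AvoidsT (suc K) (suc M) I ψ
    to ψ∈ with ∈-map⁻ (uncurry _◂_) ψ∈
    ... | (e , ψ′) , eψ′∈ , refl =
      let e∈ , ψ′∈ = ∈-cartesianProduct⁻ (heads n) (avoiders n) eψ′∈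
          ψ′-perm , ψ′-avoids = Equivalence.to (∈-avoiders n ψ′) ψ′∈
      in ◃-isPerm (proj₁ e) ψ′-perm ,
         Equivalence.from (avoidsT-◂ e ψ′-perm)
           (proj₂ (∈-filter⁻ admissible? {xs = cartesianProduct (allFin (suc n)) (allFin r)} e∈) , ψ′-avoids)

    from : IsColPerm ψ × AvoidsT (suc K) (suc M) I ψ → ψ ∈ avoiders (suc n)
    from (ψ-perm , ψ-avoids) with ◂-surjective ψ ψ-perm
    ... | (e , ψ′) , ψ′-perm , refl =
      let admissible , ψ′-avoids = Equivalence.to (avoidsT-◂ e ψ′-perm) ψ-avoids
      in ∈-map⁺ (uncurry _◂_) (∈-cartesianProduct⁺
           (∈-filter⁺ admissible? (∈-cartesianProduct⁺ (∈-allFin (proj₁ e)) (∈-allFin (proj₂ e))) admissible)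
           (Equivalence.from (∈-avoiders n ψ′) (ψ′-perm , ψ′-avoids)))

  length-heads : ∀ n → length (heads n) + (suc n ∸ K) * ∣ I ∣ ≡ suc n * r
  length-heads n = begin
    length (heads n) + (suc n ∸ K) * ∣ I ∣
      ≡⟨ cong₂ (λ w i → length (heads n) + w * i) (sym (length-filter-inWindow M D n)) (sym (length-filter-∈ I)) ⟩
    length (heads n) + length (filter (inWindow? M D n ∘ toℕ) (allFin (suc n))) * length (filter (_∈? I) (allFin r))
      ≡⟨ length-filter-∁×-cartesianProduct (inWindow? M D n ∘ toℕ) (_∈? I) (allFin (suc n)) (allFin r) ⟩
    length (allFin (suc n)) * length (allFin r)
      ≡⟨ cong₂ _*_ (Listₚ.length-tabulate {n = suc n} (λ x → x)) (Listₚ.length-tabulate {n = r} (λ x → x)) ⟩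
    suc n * r ∎
    where open ≡-Reasoning

  headCount : ℕ → ℕ
  headCount j = (r ∸ ∣ I ∣) * j + K * ∣ I ∣

  length-heads-short : ∀ {n} → n < K → length (heads n) ≡ suc n * r
  length-heads-short {n} n<K = begin
    length (heads n)                        ≡⟨ sym (+-identityʳ _) ⟩
    length (heads n) + 0 * ∣ I ∣            ≡⟨ cong (λ w → length (heads n) + w * ∣ I ∣) (sym (m≤n⇒m∸n≡0 n<K)) ⟩
    length (heads n) + (suc n ∸ K) * ∣ I ∣  ≡⟨ length-heads n ⟩
    suc n * r                               ∎
    where open ≡-Reasoning

  length-heads-long : ∀ t → length (heads (K + t)) ≡ headCount (suc (K + t))
  length-heads-long t = +-cancelʳ-≡ (suc t * ∣ I ∣) _ _ (begin
    length (heads (K + t)) + suc t * ∣ I ∣           ≡⟨ cong (λ w → length (heads (K + t)) + w * ∣ I ∣) (sym excess) ⟩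
    length (heads (K + t)) + (suc (K + t) ∸ K) * ∣ I ∣ ≡⟨ length-heads (K + t) ⟩
    suc (K + t) * r                                  ≡⟨ cong (suc (K + t) *_) (sym (m∸n+n≡m (∣p∣≤n I))) ⟩
    suc (K + t) * (r ∸ ∣ I ∣ + ∣ I ∣)                ≡⟨ split (r ∸ ∣ I ∣) ∣ I ∣ K t ⟩
    headCount (suc (K + t)) + suc t * ∣ I ∣          ∎)
    where
    open ≡-Reasoning
    excess : suc (K + t) ∸ K ≡ suc t
    excess = trans (cong (_∸ K) (sym (+-suc K t))) (m+n∸m≡n K (suc t))
    split : ∀ e d K t → suc (K + t) * (e + d) ≡ e * suc (K + t) + K * d + suc t * d
    split = solve-∀

  length-avoiders-suc : ∀ n → length (avoiders (suc n)) ≡ length (heads n) * length (avoiders n)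
  length-avoiders-suc n = trans (Listₚ.length-map (uncurry _◂_) (cartesianProduct (heads n) (avoiders n)))
                                (length-cartesianProduct (heads n) (avoiders n))

  length-avoiders-short : ∀ n → n ≤ K → length (avoiders n) ≡ n ! * r ^ n
  length-avoiders-short zero    _     = refl
  length-avoiders-short (suc n) n<K = begin
    length (avoiders (suc n))              ≡⟨ length-avoiders-suc n ⟩
    length (heads n) * length (avoiders n) ≡⟨ cong₂ _*_ (length-heads-short n<K) (length-avoiders-short n (<⇒≤ n<K)) ⟩
    suc n * r * (n ! * r ^ n)              ≡⟨ reorder (suc n) r (n !) (r ^ n) ⟩
    suc n * n ! * (r * r ^ n)              ∎
    where
    open ≡-Reasoning
    reorder : ∀ a b c d → a * b * (c * d) ≡ a * c * (b * d)
    reorder = solve-∀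

  length-avoiders-long : ∀ t → length (avoiders (K + t)) ≡ K ! * r ^ K * product (map (λ i → headCount (suc K + i)) (upTo t))
  length-avoiders-long zero rewrite +-identityʳ K = trans (length-avoiders-short K ≤-refl) (sym (*-identityʳ _))
  length-avoiders-long (suc t) rewrite +-suc K t = begin
    length (avoiders (suc (K + t)))                             ≡⟨ length-avoiders-suc (K + t) ⟩
    length (heads (K + t)) * length (avoiders (K + t))          ≡⟨ cong₂ _*_ (length-heads-long t) (length-avoiders-long t) ⟩
    headCount (suc K + t) * (K ! * r ^ K * Π t)                 ≡⟨ reorder (headCount (suc K + t)) (K ! * r ^ K) (Π t) ⟩
    K ! * r ^ K * (Π t * headCount (suc K + t))                 ≡⟨ cong (K ! * r ^ K *_) (sym (product-map-upTo-suc _ t)) ⟩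
    K ! * r ^ K * Π (suc t)                                     ∎
    where
    open ≡-Reasoning
    Π : ℕ → ℕ
    Π t = product (map (λ i → headCount (suc K + i)) (upTo t))
    reorder : ∀ a b c → a * (b * c) ≡ b * (c * a)
    reorder = solve-∀

  length-avoiders : ∀ n → K ≤ n → length (avoiders n) ≡ K ! * r ^ K * prodFromTo (suc K) n headCount
  length-avoiders n K≤n with t , refl ← m≤n⇒∃[o]m+o≡n K≤n rewrite m+n∸m≡n K t = length-avoiders-long t

theorem1 : (k r m n : ℕ) → 1 ≤ k → 1 ≤ r → 1 ≤ m → m ≤ k → k ≤ n → (I : Subset r) →
    Σ (List (ColWord n r)) λ L →
      Unique L
      × (∀ (ψ : ColWord n r) → (ψ ∈ L) ⇔ (IsColPerm ψ × AvoidsT k m I ψ))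
      × (length L ≡ ((k ∸ 1) !) * r ^ (k ∸ 1)
                     * prodFromTo k n (λ j → (r ∸ ∣ I ∣) * j + (k ∸ 1) * ∣ I ∣))
theorem1 zero    r m       n () _ _ _ _ I
theorem1 (suc K) r zero    n _ _ () _ _ I
theorem1 (suc K) r (suc M) n _ _ _ (s≤s M≤K) k≤n I with D , refl ← m≤n⇒∃[o]m+o≡n M≤K =
  avoiders M D I n , avoiders-unique M D I n , ∈-avoiders M D I n , length-avoiders M D I n (<⇒≤ k≤n)
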